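{- For every $\varepsilon>0$ there exist arbitrarily large simple graphs $G$ with no isolated vertices, with no $\Delta(G)$-weak edges, and such that $\Delta(G)\ge(2-\varepsilon)\,\mathrm{ad}(G)$.
   Context: $\Delta(G)$ is the maximum degree and $\mathrm{ad}(G)=\frac{1}{|V(G)|}\sum_{v}d(v)$ the average degree of $G$. For an integer $D$ and a vertex $u$, $d^D(u)$ denotes the number of neighbors of $u$ of degree exactly $D$. For a statement $P$, $[P]$ is $1$ if $P$ holds and $0$ otherwise. An edge $uv$ is $(D,u)$-weak if $d^D(u)\le D-d(v)+[d(v)=D]$, and $uv$ is $D$-weak if it is $(D,u)$-weak or $(D,v)$-weak.
   Formalization: The parameter ε ranges only over the positive rationals. -}

module Defs where

open import Data.Nat using (ℕ; zero; suc; _+_; _≤_; _⊔_)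
open import Data.Nat.Properties using (_≟_)
open import Data.Integer using (+_)
open import Data.Rational using (ℚ; 0ℚ; _/_)
open import Data.Fin using (Fin)
open import Data.Bool using (Bool; true; false; if_then_else_)
open import Data.List using (List; map; foldr; allFin)
open import Data.Nat.ListAction using (sum)
open import Relation.Binary.PropositionalEquality using (_≡_)
open import Relation.Nullary using (¬_)
open import Relation.Nullary.Decidable using (⌊_⌋)
open import Data.Product using (∃)
open import Data.Sum using (_⊎_)

record Graph (n : ℕ) : Set where
  field
    adj    : Fin n → Fin n → Bool
    sym    : ∀ u v → adj u v ≡ adj v u
    irrefl : ∀ v → adj v v ≡ false
open Graph public

⟦_⟧ : Bool → ℕ
⟦ b ⟧ = if b then 1 else 0

module _ {n : ℕ} (G : Graph n) where

  deg : Fin n → ℕ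
  deg v = sum (map (λ w → ⟦ adj G v w ⟧) (allFin n))

  -- Δ(G): maximum degree (0 for the empty graph)
  Δ : ℕ
  Δ = foldr _⊔_ 0 (map deg (allFin n))

  degSum : ℕ
  degSum = sum (map deg (allFin n))

  degD : ℕ → Fin n → ℕ
  degD D u = sum (map (λ w → ⟦ adj G u w ⟧ * ⟦ ⌊ deg w ≟ D ⌋ ⟧) (allFin n))
    where open Data.Nat using (_*_)

  -- uv is (D,u)-weak: d^D(u) ≤ D - d(v) + [d(v) = D]
  -- (stated equivalently over ℕ without subtraction:
  --  d^D(u) + d(v) ≤ D + [d(v) = D])
  WeakAt : ℕ → Fin n → Fin n → Set
  WeakAt D u v = degD D u + deg v ≤ D + ⟦ ⌊ deg v ≟ D ⌋ ⟧

  Weak : ℕ → Fin n → Fin n → Set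
  Weak D u v = WeakAt D u v ⊎ WeakAt D v u

  NoIsolated : Set
  NoIsolated = ∀ v → ∃ λ w → adj G v w ≡ true

  NoΔWeakEdge : Set
  NoΔWeakEdge = ∀ u v → adj G u v ≡ true → ¬ Weak Δ u v

-- ad(G) = (1/|V|) Σ d(v), as a rational (0 for the empty graph)
ad : {n : ℕ} → Graph n → ℚ
ad {zero}  G = 0ℚ
ad {suc n} G = (+ degSum G) / suc n

ℕ→ℚ : ℕ → ℚ
ℕ→ℚ k = (+ k) / 1

{-# OPTIONS --safe #-}
-- Take m clusters, each of a = 2k hubs and s = 2k − 1 satellites; all m·a hubs form one
-- clique and every satellite is joined to the hubs of its own cluster.  Hubs have degree
-- Δ = m·a − 1 + s and satellites degree a < Δ, so d^Δ counts hub neighbours: m·a − 1 at a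
-- hub, a at a satellite.  Hence a hub–hub edge is not weak since m·a − 1 ≥ 2, and a
-- hub–satellite edge is weak from neither side since a > s and a ≥ 2.  The average degree
-- is a(Δ + s)/(a + s), and (2 − 1/k)·a(Δ + s)/(a + s) ≤ Δ as soon as Δ ≥ 2s², which holds
-- once m ≥ 2s².  Choosing 1/k ≤ ε and m ≥ N gives the theorem.
module Submission where

open import Defs hiding (sym)
open import Data.Nat using (ℕ; zero; suc; pred; _+_; _*_; _≤_; _<_; _⊔_; z≤n; s≤s; z<s; >-nonZero)
open import Data.Nat.Properties
open import Data.Nat.Tactic.RingSolver using (solve)
open import Data.Fin
  using (Fin; zero; suc; _↑ˡ_; _↑ʳ_; splitAt; combine; remQuot; quotient; punchIn; fromℕ<)
open import Data.Fin.Properties using (splitAt-↑ˡ; splitAt-↑ʳ; remQuot-combine; punchInᵢ≢i)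
  renaming (_≟_ to _≟ᶠ_)
open import Data.Bool using (Bool; true; false; not)
open import Data.List using (List; _∷_; []; map; foldr; allFin; tabulate)
open import Data.List.Properties using (map-tabulate; foldr-preservesᵇ; foldr-preservesᵒ)
open import Data.List.Relation.Unary.All using (All)
open import Data.List.Relation.Unary.All.Properties as All using (tabulate⁺)
import Data.List.Relation.Unary.Any.Properties as Any
open import Data.List.Relation.Unary.Any as Any using (Any)
open import Data.List.Membership.Propositional.Properties using (∈-allFin)
import Data.Nat.ListAction as ListAction
open import Data.Product as Product using (∃; _×_; _,_)
open import Data.Sum using (_⊎_; inj₁; inj₂; [_,_]′)
open import Function using (_∘_; id)
open import Relation.Binary.PropositionalEquality
open import Relation.Binary.Definitions using (DecidableEquality)
open import Relation.Nullary using (¬_; Dec; yes; no; contradiction)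
open import Relation.Nullary.Decidable using (⌊_⌋; isYes≗does; dec-true; dec-false)
open import Algebra.Properties.Semiring.Sum +-*-semiring
  using (sum-syntax; sum-cong-≗; sum-remove; sum-replicate-zero)
open import Data.Nat.Coprimality using (Coprime)
open import Data.Integer as ℤ using (-[1+_]; +[1+_])
import Data.Integer.Properties as ℤ
open import Data.Rational as ℚ using (ℚ; mkℚ; 0ℚ; _-_; toℚᵘ)
  renaming (_*_ to _*ℚ_; _≤_ to _≤ℚ_; _<_ to _<ℚ_)
open import Data.Rational.Properties
  using (toℚᵘ-cancel-≤; toℚᵘ-homo-*; toℚᵘ-homo-+; toℚᵘ-homo‿-; toℚᵘ-fromℚᵘ)
open import Data.Rational.Unnormalised as ℚᵘ using (mkℚᵘ; *≤*)
import Data.Rational.Unnormalised.Properties as ℚᵘ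

sum-tabulate : ∀ {n} (f : Fin n → ℕ) → ListAction.sum (tabulate f) ≡ ∑[ i < n ] f i
sum-tabulate {zero}  f = refl
sum-tabulate {suc n} f = cong (f zero +_) (sum-tabulate (f ∘ suc))

sum-map-allFin : ∀ n (f : Fin n → ℕ) → ListAction.sum (map f (allFin n)) ≡ ∑[ i < n ] f i
sum-map-allFin n f = trans (cong ListAction.sum (map-tabulate id f)) (sum-tabulate f)

∑-const : ∀ n k → ∑[ _ < n ] k ≡ n * k
∑-const zero    k = refl
∑-const (suc n) k = cong (k +_) (∑-const n k)

∑-↑ : ∀ a {b} (f : Fin (a + b) → ℕ) →
      ∑[ v < a + b ] f v ≡ ∑[ i < a ] f (i ↑ˡ b) + ∑[ j < b ] f (a ↑ʳ j)
∑-↑ zero    f = refl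
∑-↑ (suc a) {b} f = trans (cong (f zero +_) (∑-↑ a (f ∘ suc)))
  (sym (+-assoc (f zero) (∑[ i < a ] f (suc (i ↑ˡ b))) (∑[ j < b ] f (suc a ↑ʳ j))))

∑-combine : ∀ m k (f : Fin (m * k) → ℕ) → ∑[ v < m * k ] f v ≡ ∑[ c < m ] ∑[ j < k ] f (combine c j)
∑-combine zero    k f = refl
∑-combine (suc m) k f =
  trans (∑-↑ k f) (cong (∑[ j < k ] f (j ↑ˡ m * k) +_) (∑-combine m k (f ∘ (k ↑ʳ_))))

∑-splitAt : ∀ a {b} (g : Fin a ⊎ Fin b → ℕ) →
            ∑[ v < a + b ] g (splitAt a v) ≡ ∑[ i < a ] g (inj₁ i) + ∑[ j < b ] g (inj₂ j)
∑-splitAt a {b} g = trans (∑-↑ a _) (cong₂ _+_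
  (sum-cong-≗ (λ i → cong g (splitAt-↑ˡ a i b)))
  (sum-cong-≗ (λ j → cong g (splitAt-↑ʳ a b j))))

∑-remQuot : ∀ m k (g : Fin m × Fin k → ℕ) →
            ∑[ v < m * k ] g (remQuot k v) ≡ ∑[ c < m ] ∑[ j < k ] g (c , j)
∑-remQuot m k g = trans (∑-combine m k _)
  (sum-cong-≗ (λ c → sum-cong-≗ (λ j → cong g (remQuot-combine c j))))

∑-except : ∀ {n} (i : Fin n) {f : Fin n → ℕ} {x y} →
           f i ≡ x → (∀ j → j ≢ i → f j ≡ y) → ∑[ j < n ] f j ≡ x + pred n * y
∑-except {suc n} i {f} {x} {y} fi≡x others = begin
  ∑[ j < suc n ] f j
    ≡⟨ sum-remove {i = i} f ⟩
  f i + ∑[ j < n ] f (punchIn i j)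
    ≡⟨ cong₂ _+_ fi≡x (sum-cong-≗ (λ j → others _ (punchInᵢ≢i i j))) ⟩
  x + ∑[ _ < n ] y
    ≡⟨ cong (x +_) (∑-const n y) ⟩
  x + n * y ∎
  where open ≡-Reasoning

∑⟦⟧-pos⇒true : ∀ {n} (b : Fin n → Bool) → 0 < ∑[ i < n ] ⟦ b i ⟧ → ∃ λ i → b i ≡ true
∑⟦⟧-pos⇒true {suc n} b pos with b zero in eq
... | true  = zero , eq
... | false = Product.map suc id (∑⟦⟧-pos⇒true (b ∘ suc) pos)

⌊⌋-true : ∀ {A : Set} (a? : Dec A) → A → ⌊ a? ⌋ ≡ true
⌊⌋-true a? a = trans (isYes≗does a?) (dec-true a? a)

⌊⌋-false : ∀ {A : Set} (a? : Dec A) → ¬ A → ⌊ a? ⌋ ≡ false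
⌊⌋-false a? ¬a = trans (isYes≗does a?) (dec-false a? ¬a)

⌊≟⌋-sym : ∀ {A : Set} (_≟_ : DecidableEquality A) x y → ⌊ x ≟ y ⌋ ≡ ⌊ y ≟ x ⌋
⌊≟⌋-sym _≟_ x y with x ≟ y | y ≟ x
... | yes _   | yes _   = refl
... | no _    | no _    = refl
... | yes x≡y | no y≢x  = contradiction (sym x≡y) y≢x
... | no x≢y  | yes y≡x = contradiction (sym y≡x) x≢y

∑-quotient-≟ : ∀ {m} k (c : Fin m) → ∑[ v < m * k ] ⟦ ⌊ c ≟ᶠ quotient k v ⌋ ⟧ ≡ k
∑-quotient-≟ {m} k c = begin
  ∑[ v < m * k ] ⟦ ⌊ c ≟ᶠ quotient k v ⌋ ⟧    ≡⟨ ∑-remQuot m k (λ { (c′ , _) → ⟦ ⌊ c ≟ᶠ c′ ⌋ ⟧ }) ⟩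
  ∑[ c′ < m ] ∑[ _ < k ] ⟦ ⌊ c ≟ᶠ c′ ⌋ ⟧      ≡⟨ sum-cong-≗ {m} (λ c′ → ∑-const k _) ⟩
  ∑[ c′ < m ] (k * ⟦ ⌊ c ≟ᶠ c′ ⌋ ⟧)           ≡⟨ ∑-except c k*[c≟c] k*[c≟c′] ⟩
  k + pred m * 0                              ≡⟨ cong (k +_) (*-zeroʳ (pred m)) ⟩
  k + 0                                       ≡⟨ +-identityʳ k ⟩
  k                                           ∎
  where
  open ≡-Reasoning
  k*[c≟c] : k * ⟦ ⌊ c ≟ᶠ c ⌋ ⟧ ≡ k
  k*[c≟c] = trans (cong (λ b → k * ⟦ b ⟧) (⌊⌋-true (c ≟ᶠ c) refl)) (*-identityʳ k)
  k*[c≟c′] : ∀ c′ → c′ ≢ c → k * ⟦ ⌊ c ≟ᶠ c′ ⌋ ⟧ ≡ 0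
  k*[c≟c′] c′ c′≢c = trans (cong (λ b → k * ⟦ b ⟧) (⌊⌋-false (c ≟ᶠ c′) (c′≢c ∘ sym))) (*-zeroʳ k)

∑-not-≟ : ∀ {n} (i : Fin n) → ∑[ j < n ] ⟦ not ⌊ i ≟ᶠ j ⌋ ⟧ ≡ pred n
∑-not-≟ {n} i = trans (∑-except i [i≢i] [i≢j]) (*-identityʳ (pred n))
  where
  [i≢i] : ⟦ not ⌊ i ≟ᶠ i ⌋ ⟧ ≡ 0
  [i≢i] = cong (λ b → ⟦ not b ⟧) (⌊⌋-true (i ≟ᶠ i) refl)
  [i≢j] : ∀ j → j ≢ i → ⟦ not ⌊ i ≟ᶠ j ⌋ ⟧ ≡ 1
  [i≢j] j j≢i = cong (λ b → ⟦ not b ⟧) (⌊⌋-false (i ≟ᶠ j) (j≢i ∘ sym))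

foldr-⊔-≡ : ∀ {D} {xs : List ℕ} → All (_≤ D) xs → Any (D ≤_) xs → foldr _⊔_ 0 xs ≡ D
foldr-⊔-≡ {xs = xs} all≤ any≥ = ≤-antisym
  (foldr-preservesᵇ ⊔-lub z≤n all≤)
  (foldr-preservesᵒ (λ x y → [ m≤n⇒m≤n⊔o y , m≤n⇒m≤o⊔n x ]′) 0 xs (inj₂ any≥))

x+n≤n+1⇒x≤1 : ∀ {x} n → x + n ≤ n + 1 → x ≤ 1
x+n≤n+1⇒x≤1 {x} n le = +-cancelʳ-≤ n x 1 (≤-trans le (≤-reflexive (+-comm n 1)))

module _ {n} (G : Graph n) where

  Δ-≡ : ∀ {D} → (∀ v → deg G v ≤ D) → ∀ v → deg G v ≡ D → Δ G ≡ D
  Δ-≡ bound v deg≡D = foldr-⊔-≡ (All.map⁺ (tabulate⁺ bound))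
    (Any.map⁺ (Any.map (λ { refl → ≤-reflexive (sym deg≡D) }) (∈-allFin v)))

  noIsolated : (∀ v → 0 < deg G v) → NoIsolated G
  noIsolated pos v = ∑⟦⟧-pos⇒true (adj G v) (subst (0 <_) (sum-map-allFin n _) (pos v))

-- m clusters of a hubs and s satellites; hub h : Fin (m * a) and satellite ℓ : Fin (m * s)
-- belong to clusters quotient a h and quotient s ℓ.
module ClusteredClique (m a s : ℕ) where

  Vertex : Set
  Vertex = Fin (m * a) ⊎ Fin (m * s)

  _~_ : Vertex → Vertex → Bool
  inj₁ h ~ inj₁ h′ = not ⌊ h ≟ᶠ h′ ⌋
  inj₁ h ~ inj₂ ℓ  = ⌊ quotient {m} a h ≟ᶠ quotient {m} s ℓ ⌋
  inj₂ ℓ ~ inj₁ h  = ⌊ quotient {m} s ℓ ≟ᶠ quotient {m} a h ⌋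
  inj₂ _ ~ inj₂ _  = false

  ~-sym : ∀ x y → x ~ y ≡ y ~ x
  ~-sym (inj₁ h) (inj₁ h′) = cong not (⌊≟⌋-sym _≟ᶠ_ h h′)
  ~-sym (inj₁ h) (inj₂ ℓ)  = ⌊≟⌋-sym _≟ᶠ_ (quotient {m} a h) (quotient {m} s ℓ)
  ~-sym (inj₂ ℓ) (inj₁ h)  = ⌊≟⌋-sym _≟ᶠ_ (quotient {m} s ℓ) (quotient {m} a h)
  ~-sym (inj₂ _) (inj₂ _)  = refl

  ~-irrefl : ∀ x → x ~ x ≡ false
  ~-irrefl (inj₁ h) = cong not (⌊⌋-true (h ≟ᶠ h) refl)
  ~-irrefl (inj₂ _) = refl

  order : ℕ
  order = m * a + m * s

  kind : Fin order → Vertex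
  kind = splitAt (m * a)

  graph : Graph order
  graph = record
    { adj    = λ v w → kind v ~ kind w
    ; sym    = λ v w → ~-sym (kind v) (kind w)
    ; irrefl = λ v → ~-irrefl (kind v)
    }

  hubNbrs : Vertex → ℕ
  hubNbrs x = ∑[ h < m * a ] ⟦ x ~ inj₁ h ⟧

  satNbrs : Vertex → ℕ
  satNbrs x = ∑[ ℓ < m * s ] ⟦ x ~ inj₂ ℓ ⟧

  hubNbrs-hub : ∀ h → hubNbrs (inj₁ h) ≡ pred (m * a)
  hubNbrs-hub = ∑-not-≟

  hubNbrs-sat : ∀ ℓ → hubNbrs (inj₂ ℓ) ≡ a
  hubNbrs-sat ℓ = ∑-quotient-≟ a (quotient {m} s ℓ)

  satNbrs-hub : ∀ h → satNbrs (inj₁ h) ≡ s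
  satNbrs-hub h = ∑-quotient-≟ s (quotient {m} a h)

  satNbrs-sat : ∀ ℓ → satNbrs (inj₂ ℓ) ≡ 0
  satNbrs-sat _ = sum-replicate-zero (m * s)

  hubDegree : ℕ
  hubDegree = pred (m * a) + s

  degree : Vertex → ℕ
  degree (inj₁ _) = hubDegree
  degree (inj₂ _) = a

  nbrs≡degree : ∀ x → hubNbrs x + satNbrs x ≡ degree x
  nbrs≡degree (inj₁ h) = cong₂ _+_ (hubNbrs-hub h) (satNbrs-hub h)
  nbrs≡degree (inj₂ ℓ) = trans (cong₂ _+_ (hubNbrs-sat ℓ) (satNbrs-sat ℓ)) (+-identityʳ a)

  deg-graph : ∀ v → deg graph v ≡ degree (kind v)
  deg-graph v = begin
    deg graph v                              ≡⟨ sum-map-allFin order _ ⟩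
    ∑[ w < order ] ⟦ kind v ~ kind w ⟧        ≡⟨ ∑-splitAt (m * a) (λ y → ⟦ kind v ~ y ⟧) ⟩
    hubNbrs (kind v) + satNbrs (kind v)      ≡⟨ nbrs≡degree (kind v) ⟩
    degree (kind v)                          ∎
    where open ≡-Reasoning

  degSum-graph : degSum graph ≡ m * a * hubDegree + m * s * a
  degSum-graph = begin
    degSum graph                                 ≡⟨ sum-map-allFin order (deg graph) ⟩
    ∑[ v < order ] deg graph v                   ≡⟨ sum-cong-≗ deg-graph ⟩
    ∑[ v < order ] degree (kind v)               ≡⟨ ∑-splitAt (m * a) degree ⟩
    ∑[ _ < m * a ] hubDegree + ∑[ _ < m * s ] a  ≡⟨ cong₂ _+_ (∑-const (m * a) hubDegree)
                                                                 (∑-const (m * s) a) ⟩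
    m * a * hubDegree + m * s * a                ∎
    where open ≡-Reasoning

  module Admissible (1<m : 1 < m) (0<s : 0 < s) (s<a : s < a) where

    0<a : 0 < a
    0<a = ≤-<-trans z≤n s<a

    1<a : 1 < a
    1<a = ≤-<-trans 0<s s<a

    a<m*a : a < m * a
    a<m*a = <-≤-trans (m<m*n a m ⦃ >-nonZero 0<a ⦄ 1<m) (≤-reflexive (*-comm a m))

    1<pred[m*a] : 1 < pred (m * a)
    1<pred[m*a] = <-≤-trans 1<a (<⇒≤pred a<m*a)

    a<hubDegree : a < hubDegree
    a<hubDegree = ≤-<-trans (<⇒≤pred a<m*a) (m<m+n (pred (m * a)) 0<s)

    degree≤hubDegree : ∀ x → degree x ≤ hubDegree
    degree≤hubDegree (inj₁ _) = ≤-refl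
    degree≤hubDegree (inj₂ _) = <⇒≤ a<hubDegree

    Δ-graph : Δ graph ≡ hubDegree
    Δ-graph = Δ-≡ graph (λ v → subst (_≤ hubDegree) (sym (deg-graph v)) (degree≤hubDegree (kind v)))
      hub (trans (deg-graph hub) (cong degree (splitAt-↑ˡ (m * a) hub₀ (m * s))))
      where
      hub₀ : Fin (m * a)
      hub₀ = fromℕ< (≤-<-trans z≤n a<m*a)
      hub : Fin order
      hub = hub₀ ↑ˡ m * s

    noIsolated-graph : NoIsolated graph
    noIsolated-graph =
      noIsolated graph (λ v → subst (0 <_) (sym (deg-graph v)) (degree-pos (kind v)))
      where
      degree-pos : ∀ x → 0 < degree x
      degree-pos (inj₁ _) = <-trans 0<a a<hubDegree
      degree-pos (inj₂ _) = 0<a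

    isHub : Vertex → ℕ
    isHub (inj₁ _) = 1
    isHub (inj₂ _) = 0

    [deg≟hubDegree] : ∀ w → ⟦ ⌊ deg graph w ≟ hubDegree ⌋ ⟧ ≡ isHub (kind w)
    [deg≟hubDegree] w = trans (cong (λ d → ⟦ ⌊ d ≟ hubDegree ⌋ ⟧) (deg-graph w)) (by-kind (kind w))
      where
      by-kind : ∀ x → ⟦ ⌊ degree x ≟ hubDegree ⌋ ⟧ ≡ isHub x
      by-kind (inj₁ _) = cong ⟦_⟧ (⌊⌋-true (hubDegree ≟ hubDegree) refl)
      by-kind (inj₂ _) = cong ⟦_⟧ (⌊⌋-false (a ≟ hubDegree) (<⇒≢ a<hubDegree))

    degD-graph : ∀ u → degD graph hubDegree u ≡ hubNbrs (kind u)
    degD-graph u = begin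
      degD graph hubDegree u
        ≡⟨ sum-map-allFin order _ ⟩
      ∑[ w < order ] (⟦ kind u ~ kind w ⟧ * ⟦ ⌊ deg graph w ≟ hubDegree ⌋ ⟧)
        ≡⟨ sum-cong-≗ (λ w → cong (⟦ kind u ~ kind w ⟧ *_) ([deg≟hubDegree] w)) ⟩
      ∑[ w < order ] (⟦ kind u ~ kind w ⟧ * isHub (kind w))
        ≡⟨ ∑-splitAt (m * a) (λ y → ⟦ kind u ~ y ⟧ * isHub y) ⟩
      ∑[ h < m * a ] (⟦ kind u ~ inj₁ h ⟧ * 1) + ∑[ ℓ < m * s ] (⟦ kind u ~ inj₂ ℓ ⟧ * 0)
        ≡⟨ cong₂ _+_ (sum-cong-≗ (λ h → *-identityʳ ⟦ kind u ~ inj₁ h ⟧))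
                     (sum-cong-≗ (λ ℓ → *-zeroʳ ⟦ kind u ~ inj₂ ℓ ⟧)) ⟩
      hubNbrs (kind u) + ∑[ _ < m * s ] 0
        ≡⟨ cong (hubNbrs (kind u) +_) (sum-replicate-zero (m * s)) ⟩
      hubNbrs (kind u) + 0
        ≡⟨ +-identityʳ _ ⟩
      hubNbrs (kind u) ∎
      where open ≡-Reasoning

    ¬weak : ∀ x y → x ~ y ≡ true → ¬ (hubNbrs x + degree y ≤ hubDegree + isHub y)
    ¬weak (inj₁ h) (inj₁ _) _ weak =
      <⇒≱ 1<pred[m*a] (subst (_≤ 1) (hubNbrs-hub h) (x+n≤n+1⇒x≤1 hubDegree weak))
    ¬weak (inj₁ h) (inj₂ _) _ weak =
      <⇒≱ s<a (+-cancelˡ-≤ (pred (m * a)) a s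
        (subst₂ _≤_ (cong (_+ a) (hubNbrs-hub h)) (+-identityʳ hubDegree) weak))
    ¬weak (inj₂ ℓ) (inj₁ _) _ weak =
      <⇒≱ 1<a (subst (_≤ 1) (hubNbrs-sat ℓ) (x+n≤n+1⇒x≤1 hubDegree weak))
    ¬weak (inj₂ _) (inj₂ _) ()

    weakAt-closed-form : ∀ u v → WeakAt graph hubDegree u v →
                         hubNbrs (kind u) + degree (kind v) ≤ hubDegree + isHub (kind v)
    weakAt-closed-form u v =
      subst₂ _≤_ (cong₂ _+_ (degD-graph u) (deg-graph v)) (cong (hubDegree +_) ([deg≟hubDegree] v))

    noΔWeakEdge-graph : NoΔWeakEdge graph
    noΔWeakEdge-graph u v uv weak with subst (λ D → Weak graph D u v) Δ-graph weak
    ... | inj₁ weak-u = ¬weak (kind u) (kind v) uv (weakAt-closed-form u v weak-u)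
    ... | inj₂ weak-v =
      ¬weak (kind v) (kind u) (trans (~-sym (kind v) (kind u)) uv) (weakAt-closed-form v u weak-v)

    m≤hubDegree : m ≤ hubDegree
    m≤hubDegree = ≤-trans (<⇒≤pred (m<m*n m a ⦃ >-nonZero (<-trans z<s 1<m) ⦄ 1<a))
                          (m≤m+n (pred (m * a)) s)

    m≤order : m ≤ order
    m≤order = ≤-trans (m≤m*n m a ⦃ >-nonZero 0<a ⦄) (m≤m+n (m * a) (m * s))

-- s · (degree sum) ≤ Δ · k · (order) for the clustered clique with a = 2k, s = 2k − 1.
mean-degree-bound : ∀ k s M D → suc s ≡ k + k → s * s + s * s ≤ D →
                    s * (M * suc s * D + M * s * suc s) ≤ D * (k * (M * suc s + M * s))
mean-degree-bound k s M D a≡k+k 2s²≤D = begin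
  s * (M * suc s * D + M * s * suc s)  ≡⟨ solve (s ∷ M ∷ D ∷ []) ⟩
  M * suc s * (s * (D + s))            ≡⟨ cong (λ a → M * a * (s * (D + s))) a≡k+k ⟩
  M * (k + k) * (s * (D + s))          ≡⟨ solve (k ∷ s ∷ M ∷ D ∷ []) ⟩
  k * M * ((s + s) * (D + s))          ≤⟨ *-monoʳ-≤ (k * M) 2s[D+s]≤[2s+1]D ⟩
  k * M * (suc (s + s) * D)            ≡⟨ solve (k ∷ s ∷ M ∷ D ∷ []) ⟩
  D * (k * (M * suc s + M * s))        ∎
  where
  open ≤-Reasoning
  2s[D+s]≤[2s+1]D : (s + s) * (D + s) ≤ suc (s + s) * D
  2s[D+s]≤[2s+1]D = begin
    (s + s) * (D + s)              ≡⟨ solve (s ∷ D ∷ []) ⟩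
    (s + s) * D + (s * s + s * s)  ≤⟨ +-monoʳ-≤ ((s + s) * D) 2s²≤D ⟩
    (s + s) * D + D                ≡⟨ solve (s ∷ D ∷ []) ⟩
    suc (s + s) * D                ∎

-- For ε = (p + 1)/k with k = q + 1 it suffices that (2k − 1) S ≤ k D n, as ε ≥ 1/k.
[2-ε]*[S/n]≤ᵘD : ∀ p q S n D → (q + suc q) * S ≤ D * (suc q * suc n) →
                 (mkℚᵘ (ℤ.+ 2) 0 ℚᵘ.- mkℚᵘ +[1+ p ] q) ℚᵘ.* mkℚᵘ (ℤ.+ S) n ℚᵘ.≤ mkℚᵘ (ℤ.+ D) 0
[2-ε]*[S/n]≤ᵘD p q S n D bound = *≤* (begin
  (ℤ.+ 2 ℤ.* ℤ.+ suc q ℤ.+ -[1+ p ] ℤ.* ℤ.+ 1) ℤ.* ℤ.+ S ℤ.* ℤ.+ 1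
    ≡⟨ ℤ.*-identityʳ _ ⟩
  (ℤ.+ 2 ℤ.* ℤ.+ suc q ℤ.+ -[1+ p ] ℤ.* ℤ.+ 1) ℤ.* ℤ.+ S
    ≤⟨ ℤ.*-monoʳ-≤-nonNeg (ℤ.+ S) numerator≤ ⟩
  ℤ.+ (q + suc q) ℤ.* ℤ.+ S           ≡⟨ ℤ.pos-* (q + suc q) S ⟨
  ℤ.+ ((q + suc q) * S)               ≤⟨ ℤ.+≤+ bound ⟩
  ℤ.+ (D * (suc q * suc n))           ≡⟨ ℤ.pos-* D (suc q * suc n) ⟩
  ℤ.+ D ℤ.* ℤ.+ (suc q * suc n)       ≡⟨ cong (λ k → ℤ.+ D ℤ.* ℤ.+ (suc k * suc n))
                                                (+-identityʳ q) ⟨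
  ℤ.+ D ℤ.* ℤ.+ (suc (q + 0) * suc n) ∎)
  where
  open ℤ.≤-Reasoning
  -- The denominator 1 * suc q of 2 − ε computes to suc (q + 0).
  numerator≤ : ℤ.+ 2 ℤ.* ℤ.+ suc q ℤ.+ -[1+ p ] ℤ.* ℤ.+ 1 ℤ.≤ ℤ.+ (q + suc q)
  numerator≤ = ℤ.≤-trans
    (ℤ.+-monoʳ-≤ (ℤ.+ 2 ℤ.* ℤ.+ suc q)
      (ℤ.≤-trans (ℤ.≤-reflexive (ℤ.*-identityʳ -[1+ p ])) (ℤ.-≤- z≤n)))
    (ℤ.≤-reflexive (cong (λ k → ℤ.+ (q + suc k)) (+-identityʳ q)))

[2-ε]*[S/n]≤D : ∀ p q .{c : Coprime (suc p) (suc q)} S n D →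
                (q + suc q) * S ≤ D * (suc q * suc n) →
                (ℕ→ℚ 2 - mkℚ +[1+ p ] q c) *ℚ (ℤ.+ S ℚ./ suc n) ≤ℚ ℕ→ℚ D
[2-ε]*[S/n]≤D p q {c} S n D bound = toℚᵘ-cancel-≤ (begin
  toℚᵘ ((ℕ→ℚ 2 - ε) *ℚ (ℤ.+ S ℚ./ suc n))
    ≃⟨ toℚᵘ-homo-* (ℕ→ℚ 2 - ε) _ ⟩
  toℚᵘ (ℕ→ℚ 2 - ε) ℚᵘ.* toℚᵘ (ℤ.+ S ℚ./ suc n)
    ≃⟨ ℚᵘ.*-cong 2-ε≃ (toℚᵘ-fromℚᵘ (mkℚᵘ (ℤ.+ S) n)) ⟩
  (mkℚᵘ (ℤ.+ 2) 0 ℚᵘ.- mkℚᵘ +[1+ p ] q) ℚᵘ.* mkℚᵘ (ℤ.+ S) n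
    ≤⟨ [2-ε]*[S/n]≤ᵘD p q S n D bound ⟩
  mkℚᵘ (ℤ.+ D) 0
    ≃⟨ toℚᵘ-fromℚᵘ (mkℚᵘ (ℤ.+ D) 0) ⟨
  toℚᵘ (ℕ→ℚ D) ∎)
  where
  open ℚᵘ.≤-Reasoning
  ε = mkℚ +[1+ p ] q c
  2-ε≃ : toℚᵘ (ℕ→ℚ 2 - ε) ℚᵘ.≃ mkℚᵘ (ℤ.+ 2) 0 ℚᵘ.- mkℚᵘ +[1+ p ] q
  2-ε≃ = ℚᵘ.≃-trans (toℚᵘ-homo-+ (ℕ→ℚ 2) (ℚ.- ε))
           (ℚᵘ.+-cong (toℚᵘ-fromℚᵘ (mkℚᵘ (ℤ.+ 2) 0)) (toℚᵘ-homo‿- ε))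

theorem4 : (ε : ℚ) → 0ℚ <ℚ ε → (N : ℕ) →
    ∃ λ n → N ≤ n × ∃ λ (G : Graph n) →
      NoIsolated G × NoΔWeakEdge G ×
      (ℕ→ℚ 2 - ε) *ℚ ad G ≤ℚ ℕ→ℚ (Δ G)
theorem4 (mkℚ +[1+ p ] q c) _ N =
  order , N≤order , graph , noIsolated-graph , noΔWeakEdge-graph , mean-degree-ratio
  where
  s = q + suc q
  m = 2 + (N + (s * s + s * s))
  open ClusteredClique m (suc s) s
  1<m : 1 < m
  1<m = s≤s (s≤s z≤n)
  0<s : 0 < s
  0<s = <-≤-trans z<s (m≤n+m (suc q) q)
  open Admissible 1<m 0<s (n<1+n s)
  N≤order : N ≤ order
  N≤order = ≤-trans (≤-trans (m≤m+n N _) (m≤n+m _ 2)) m≤order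
  2s²≤hubDegree : s * s + s * s ≤ hubDegree
  2s²≤hubDegree = ≤-trans (≤-trans (m≤n+m _ N) (m≤n+m _ 2)) m≤hubDegree
  mean-degree-ratio : (ℕ→ℚ 2 - mkℚ +[1+ p ] q c) *ℚ ad graph ≤ℚ ℕ→ℚ (Δ graph)
  mean-degree-ratio = [2-ε]*[S/n]≤D p q {c} (degSum graph) _ (Δ graph)
    (subst₂ (λ S D → s * S ≤ D * (suc q * order)) (sym degSum-graph) (sym Δ-graph)
      (mean-degree-bound (suc q) s m hubDegree refl 2s²≤hubDegree))
theorem4 (mkℚ (ℤ.+ 0) _ _) (ℚ.*<* (ℤ.+<+ ())) _
theorem4 (mkℚ -[1+ _ ] _ _) (ℚ.*<* ()) _
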